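{- Let $\mathfrak{M}=(W,\le,\mathcal{I})$ be an $\mathsf{IFOM}$-structure. For all $w\in W$, $x\in\mathcal{I}(\mathsf{s},w)$ and $\phi\in\mathcal{L}_{\Box\Diamond}$: $\mathfrak{M},w,x\models\phi$ if and only if $\mathfrak{M}^{\bullet},\langle w,x\rangle\Vdash\phi$.
   Context: $\mathcal{L}_{\Box\Diamond}$: formulas $\phi ::= p_i \mid \bot \mid \phi\wedge\phi \mid \phi\vee\phi \mid \phi\to\phi \mid \Box\phi\mid\Diamond\phi$. $\mathsf{IFOM}$-structures: $\mathfrak{M}=(W,\le,\mathcal{I})$ with $(W,\le)$ a poset and, for each $w$, sets $\mathcal{I}(\mathsf{s},w),\mathcal{I}(\mathsf{n},w)$, relations $\mathcal{I}(\mathsf{N},w)\subseteq\mathcal{I}(\mathsf{s},w)\times\mathcal{I}(\mathsf{n},w)$, $\mathcal{I}(\mathsf{E},w)\subseteq\mathcal{I}(\mathsf{n},w)\times\mathcal{I}(\mathsf{s},w)$, $\mathcal{I}(P_i,w)\subseteq\mathcal{I}(\mathsf{s},w)$, all increasing along $\le$. Evaluation at $(w,x)$ with $x\in\mathcal{I}(\mathsf{s},w)$: $w,x\models p_i$ iff $x\in\mathcal{I}(P_i,w)$; $\bot$ never; $\wedge,\vee$ pointwise; $w,x\models\phi\to\psi$ iff for all $w'\ge w$, $w',x\models\phi$ implies $w',x\models\psi$; $w,x\models\Box\phi$ iff there is $a\in\mathcal{I}(\mathsf{n},w)$ with $(x,a)\in\mathcal{I}(\mathsf{N},w)$ such that for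 all $w'\ge w$, $x'\in\mathcal{I}(\mathsf{s},w')$ with $(a,x')\in\mathcal{I}(\mathsf{E},w')$, $w',x'\models\phi$; $w,x\models\Diamond\phi$ iff for all $w'\ge w$ and $a'\in\mathcal{I}(\mathsf{n},w')$ with $(x,a')\in\mathcal{I}(\mathsf{N},w')$ there is $y'\in\mathcal{I}(\mathsf{s},w')$ with $(a',y')\in\mathcal{I}(\mathsf{E},w')$ and $w',y'\models\phi$. Intuitionistic neighbourhood models $(W,\le,N,V)$: $N$ a set of partial functions $a:W\rightharpoonup\mathcal{P}(W)$ with upset domains, $V$ mapping letters to upsets; $N_w=\{a\in N\mid w\in\mathrm{dom}(a)\}$; $w\Vdash\Box\phi$ iff there is $a\in N_w$ with $v\Vdash\phi$ for all $w'\ge w$ and $v\in a(w')$; $w\Vdash\Diamond\phi$ iff for all $w'\ge w$ and $a\in N_{w'}$ some $v\in a(w')$ has $v\Vdash\phi$; other clauses as in intuitionistic Kripke semantics. The model $\mathfrak{M}^{\bullet}=(W^{\bullet},\leqq,N^{\bullet},V^{\bullet})$: $W^{\bullet}=\{\langle w,x\rangle\mid w\in W,x\in\mathcal{I}(\mathsf{s},w)\}$; $\langle w,x\rangle\leqq\langle w',x'\rangle$ iff $w\le w'$ and $x=x'$; for $a\in\bigcup_w\mathcal{I}(\mathsf{n},w)$, $a^{\bullet}(\langle w,x\rangle)=\{\langle w,y\rangle\in W^{\bullet}\mid(a,y)\in\mathcal{I}(\mathsf{E},w)\}$ if $a\in\mathcal{I}(\mathsf{n},w)$ and $(x,a)\in\mathcal{I}(\mathsf{N},w)$,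 undefined otherwise; $N^{\bullet}=\{a^{\bullet}\mid a\in\mathcal{I}(\mathsf{n},w)\text{ for some }w\}$; $V^{\bullet}(p_i)=\{\langle w,x\rangle\mid x\in\mathcal{I}(P_i,w)\}$. -}

module Defs where

open import Data.Nat using (ℕ)
open import Data.Product using (Σ; ∃; _×_; _,_; proj₁)
open import Data.Sum using (_⊎_)
open import Data.Empty using (⊥)
open import Relation.Binary.PropositionalEquality using (_≡_)
open import Relation.Binary.Structures using (IsPartialOrder)

infixr 5 _⇒_
infixr 6 _∨_
infixr 7 _∧_
data Form : Set where
  var  : ℕ → Form
  ⊥'   : Form
  _∧_  : Form → Form → Form
  _∨_  : Form → Form → Form
  _⇒_  : Form → Form → Form
  □    : Form → Form
  ◇    : Form → Form

-- IFOM-structures.  The two sorts s, n are given by global carriers Ds, Dn;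
-- I(s,w), I(n,w), I(N,w), I(E,w), I(P_i,w) are predicates, increasing along ≤.
record IFOM : Set₁ where
  field
    W     : Set
    _≤_   : W → W → Set
    isPO  : IsPartialOrder _≡_ _≤_
    Ds    : Set
    Dn    : Set
    Is    : W → Ds → Set
    In    : W → Dn → Set
    IN    : W → Ds → Dn → Set
    IE    : W → Dn → Ds → Set
    IP    : ℕ → W → Ds → Set
    IN-typed : ∀ {w x a} → IN w x a → Is w x × In w a
    IE-typed : ∀ {w a x} → IE w a x → In w a × Is w x
    IP-typed : ∀ {i w x} → IP i w x → Is w x
    Is-mono : ∀ {w w' x} → w ≤ w' → Is w x → Is w' x
    In-mono : ∀ {w w' a} → w ≤ w' → In w a → In w' a
    IN-mono : ∀ {w w' x a} → w ≤ w' → IN w x a → IN w' x a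
    IE-mono : ∀ {w w' a x} → w ≤ w' → IE w a x → IE w' a x
    IP-mono : ∀ {i w w' x} → w ≤ w' → IP i w x → IP i w' x

module _ (M : IFOM) where
  open IFOM M

  sat : W → Ds → Form → Set
  sat w x (var i) = IP i w x
  sat w x ⊥' = ⊥
  sat w x (φ ∧ ψ) = sat w x φ × sat w x ψ
  sat w x (φ ∨ ψ) = sat w x φ ⊎ sat w x ψ
  sat w x (φ ⇒ ψ) = ∀ w' → w ≤ w' → sat w' x φ → sat w' x ψ
  sat w x (□ φ) = Σ Dn λ a → In w a × IN w x a ×
    (∀ w' x' → w ≤ w' → Is w' x' → IE w' a x' → sat w' x' φ)
  sat w x (◇ φ) = ∀ w' a' → w ≤ w' → In w' a' → IN w' x a' →
    Σ Ds λ y' → Is w' y' × IE w' a' y' × sat w' y' φ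

-- Intuitionistic neighbourhood models (W, ≤, N, V).
-- N is given as an index type NI of partial functions a : W ⇀ P(W):
-- dom a w  means  w ∈ dom(a);  app a w v  means  v ∈ a(w)  (for w ∈ dom(a)).
record NModel : Set₁ where
  field
    W   : Set
    _≤_ : W → W → Set
    NI  : Set
    dom : NI → W → Set
    app : NI → W → W → Set
    V   : ℕ → W → Set

module _ (M : NModel) where
  open NModel M

  forces : W → Form → Set
  forces w (var i) = V i w
  forces w ⊥' = ⊥
  forces w (φ ∧ ψ) = forces w φ × forces w ψ
  forces w (φ ∨ ψ) = forces w φ ⊎ forces w ψ
  forces w (φ ⇒ ψ) = ∀ w' → w ≤ w' → forces w' φ → forces w' ψ
  forces w (□ φ) = Σ NI λ a → dom a w ×
    (∀ w' v → w ≤ w' → dom a w' → app a w' v → forces v φ)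
  forces w (◇ φ) = ∀ w' a → w ≤ w' → dom a w' →
    Σ W λ v → app a w' v × forces v φ

bullet : IFOM → NModel
bullet M = record
  { W   = Σ W λ w → Σ Ds λ x → Is w x
  ; _≤_ = λ { (w , x , _) (w' , x' , _) → (w ≤ w') × (x ≡ x') }
  ; NI  = Σ Dn λ a → Σ W λ w → In w a
  ; dom = λ { (a , _) (w , x , _) → In w a × IN w x a }
  ; app = λ { (a , _) (w , x , _) (w'' , y , _) →
              (In w a × IN w x a) × (w'' ≡ w) × IE w a y }
  ; V   = λ { i (w , x , _) → IP i w x }
  }
  where open IFOM M

{-# OPTIONS --safe #-}
-- The points of M• above ⟨w , x⟩ are exactly the ⟨w' , x⟩ with
-- w ≤ w', and a•(⟨w' , x⟩) = {⟨w' , y⟩ ∣ (a , y) ∈ I(E , w')}, so each clause of ⊩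
-- unfolds to the corresponding clause of ⊨.  The only point needing care is that a
-- point of M• carries a proof of x ∈ I(s , w); at later worlds one is supplied by
-- monotonicity of I(s , -), and by the induction hypothesis the choice is irrelevant.
module Submission where

open import Defs
open import Data.Product using (_,_; _×_)
open import Data.Product.Function.NonDependent.Propositional using (_×-⇔_)
open import Data.Sum.Function.Propositional using (_⊎-⇔_)
open import Function.Bundles using (_⇔_; mk⇔; module Equivalence)
open import Function.Properties.Equivalence using () renaming (refl to ⇔-refl)
open import Relation.Binary.PropositionalEquality using (refl)

module _ (M : IFOM) where
  open IFOM M
  open Equivalence
  open NModel (bullet M) using (NI; dom; app) renaming (_≤_ to _≤•_)

  Agrees : Form → Set
  Agrees φ = ∀ {w x} (xs : Is w x) → sat M w x φ ⇔ forces (bullet M) (w , x , xs) φ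

  ⇒-agrees : ∀ {φ ψ} → Agrees φ → Agrees ψ → Agrees (φ ⇒ ψ)
  ⇒-agrees {φ} {ψ} ihφ ihψ {w} {x} xs = mk⇔ sat⇒forces forces⇒sat
    where
    sat⇒forces : sat M w x (φ ⇒ ψ) → forces (bullet M) (w , x , xs) (φ ⇒ ψ)
    sat⇒forces h (w' , .x , xs') (w≤w' , refl) f = to (ihψ xs') (h w' w≤w' (from (ihφ xs') f))

    forces⇒sat : forces (bullet M) (w , x , xs) (φ ⇒ ψ) → sat M w x (φ ⇒ ψ)
    forces⇒sat h w' w≤w' s = from (ihψ xs') (h (w' , x , xs') (w≤w' , refl) (to (ihφ xs') s))
      where
      xs' : Is w' x
      xs' = Is-mono w≤w' xs

  □-agrees : ∀ {φ} → Agrees φ → Agrees (□ φ)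
  □-agrees {φ} ih {w} {x} xs = mk⇔ sat⇒forces forces⇒sat
    where
    sat⇒forces : sat M w x (□ φ) → forces (bullet M) (w , x , xs) (□ φ)
    sat⇒forces (a , a∈n , xNa , h) = a• , (a∈n , xNa) , all-φ
      where
      a• : NI
      a• = a , w , a∈n
      all-φ : ∀ p v → (w , x , xs) ≤• p → dom a• p → app a• p v → forces (bullet M) v φ
      all-φ (w' , .x , _) (.w' , y , ys) (w≤w' , refl) _ (_ , refl , aEy) =
        to (ih ys) (h w' y w≤w' ys aEy)

    forces⇒sat : forces (bullet M) (w , x , xs) (□ φ) → sat M w x (□ φ)
    forces⇒sat ((a , _) , (a∈n , xNa) , h) = a , a∈n , xNa , all-φ
      where
      all-φ : ∀ w' y → w ≤ w' → (ys : Is w' y) → IE w' a y → sat M w' y φ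
      all-φ w' y w≤w' ys aEy = from (ih ys) (h (w' , x , Is-mono w≤w' xs) (w' , y , ys)
        (w≤w' , refl) a∈dom (a∈dom , refl , aEy))
        where
        a∈dom : In w' a × IN w' x a
        a∈dom = In-mono w≤w' a∈n , IN-mono w≤w' xNa

  ◇-agrees : ∀ {φ} → Agrees φ → Agrees (◇ φ)
  ◇-agrees {φ} ih {w} {x} xs = mk⇔ sat⇒forces forces⇒sat
    where
    sat⇒forces : sat M w x (◇ φ) → forces (bullet M) (w , x , xs) (◇ φ)
    sat⇒forces h (w' , .x , _) (a , _) (w≤w' , refl) a∈dom@(a∈n , xNa)
      with h w' a w≤w' a∈n xNa
    ... | y , ys , aEy , s = (w' , y , ys) , (a∈dom , refl , aEy) , to (ih ys) s

    forces⇒sat : forces (bullet M) (w , x , xs) (◇ φ) → sat M w x (◇ φ)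
    forces⇒sat h w' a w≤w' a∈n xNa
      with h (w' , x , Is-mono w≤w' xs) (a , w' , a∈n) (w≤w' , refl) (a∈n , xNa)
    ... | (.w' , y , ys) , (_ , refl , aEy) , f = y , ys , aEy , from (ih ys) f

  agrees : ∀ φ → Agrees φ
  agrees (var i) xs = ⇔-refl
  agrees ⊥' xs = ⇔-refl
  agrees (φ ∧ ψ) xs = agrees φ xs ×-⇔ agrees ψ xs
  agrees (φ ∨ ψ) xs = agrees φ xs ⊎-⇔ agrees ψ xs
  agrees (φ ⇒ ψ) = ⇒-agrees {φ} {ψ} (agrees φ) (agrees ψ)
  agrees (□ φ) = □-agrees {φ} (agrees φ)
  agrees (◇ φ) = ◇-agrees {φ} (agrees φ)

proposition3p8 : (M : IFOM) → ∀ (w : IFOM.W M) (x : IFOM.Ds M) (xs : IFOM.Is M w x) (φ : Form) →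
    sat M w x φ ⇔ forces (bullet M) (w , x , xs) φ
proposition3p8 M w x xs φ = agrees M φ xs
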